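{- $\langle\mathrm{nwd}({}^{<\omega}2),\perp^*,\mathrm{suc}({}^{<\omega}2)\rangle\equiv_{\mathrm T}\mathbf{D}({}^{<\omega}2)$.
   Context: Order ${}^{<\omega}2$ by: $s<t$ iff ($t\subset s$ and $s(|t|)=0$) or ($s\subset t$ and $t(|s|)=1$) or ($s,t$ incompatible and $s(k)<t(k)$ at their first point of difference $k$); this is a dense linear order without endpoints (a copy of the rationals), given the order topology. In this space, $D$ is dense iff every $s$ has an extension $t\supseteq s$ in $D$, and $N$ is nowhere dense iff there is a maximal antichain $A\subseteq{}^{<\omega}2$ (w.r.t. $\subseteq$) such that every $s\in N$ is $\subseteq$ some $t\in A$. $\mathrm{Dense}({}^{<\omega}2)$ is the set of dense subsets and $\mathrm{nwd}({}^{<\omega}2)$ the ideal of nowhere dense subsets. $\mathbf{D}({}^{<\omega}2)=\langle\mathrm{nwd}({}^{<\omega}2),\perp^*,\mathrm{Dense}({}^{<\omega}2)\rangle$ where $N\perp^*D$ iff $N\cap D$ is finite. $\mathrm{suc}({}^{<\omega}2)$ is the set of sequences $\langle x_i:i<\omega\rangle$ of elements of ${}^{<\omega}2$ such that for every $s$ there is $k$ with $x_i<s$ for all $i\ge k$; for such a sequence, $N\perp^*\langle x_i\rangle$ iff $\{i:x_i\in N\}$ is finite. A relational system is a triple $\langle A_-,A,A_+\rangle$ with $A\subseteq A_-\times A_+$; a generalized Galois–Tukey connection from $\mathbf{A}$ to $\mathbf{B}$ is a pair $\varphi_-\colon A_-\to B_-$, $\varphi_+\colon B_+\to A_+$ with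 $\langle\varphi_-(a),b\rangle\in B\Rightarrow\langle a,\varphi_+(b)\rangle\in A$; $\mathbf{A}\le_{\mathrm T}\mathbf{B}$ means one exists and $\mathbf{A}\equiv_{\mathrm T}\mathbf{B}$ means both directions hold. -}

module Defs where

open import Level using (Lift; lower; suc; zero)

open import Data.Bool using (Bool; true; false)
open import Data.List using (List; []; _∷_; _++_)
open import Data.List.Membership.Propositional using (_∈_)
open import Data.Nat using (ℕ; _≤_; _<_)
open import Data.Product using (Σ; _×_; proj₁; ∃; ∃-syntax)
open import Data.Sum using (_⊎_)
open import Relation.Binary.PropositionalEquality using (_≡_)

Seq : Set
Seq = List Bool

Subset : Set₁
Subset = Seq → Set

_⊑_ : Seq → Seq → Set
s ⊑ t = ∃[ u ] (s ++ u ≡ t)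

Compatible : Seq → Seq → Set
Compatible s t = s ⊑ t ⊎ t ⊑ s

-- The linear order on 2^{<ω}:
--  (t ⊂ s and s(|t|) = 0)  i.e.  s = t ++ 0 ∷ u
--  (s ⊂ t and t(|s|) = 1)  i.e.  t = s ++ 1 ∷ v
--  incompatible, first difference k with s(k) = 0 < 1 = t(k)
--    i.e. s = c ++ 0 ∷ u, t = c ++ 1 ∷ v
_≺_ : Seq → Seq → Set
s ≺ t =
  (∃[ u ] (s ≡ t ++ (false ∷ u)))
  ⊎ (∃[ v ] (t ≡ s ++ (true ∷ v)))
  ⊎ (∃[ c ] ∃[ u ] ∃[ v ] (s ≡ c ++ (false ∷ u) × t ≡ c ++ (true ∷ v)))

FiniteSubset : Subset → Set
FiniteSubset P = ∃[ xs ] (∀ s → P s → s ∈ xs)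

FiniteNat : (ℕ → Set) → Set
FiniteNat P = ∃[ k ] (∀ i → P i → i < k)

IsDense : Subset → Set
IsDense D = ∀ s → ∃[ t ] (s ⊑ t × D t)

IsAntichain : Subset → Set
IsAntichain A = ∀ s t → A s → A t → s ⊑ t → s ≡ t

IsMaximalAntichain : Subset → Set
IsMaximalAntichain A = IsAntichain A × (∀ s → ∃[ t ] (A t × Compatible s t))

IsNwd : Subset → Set₁
IsNwd N = Σ Subset (λ A → IsMaximalAntichain A × (∀ s → N s → ∃[ t ] (A t × s ⊑ t)))

Nwd : Set₁
Nwd = Σ Subset IsNwd

Dense : Set₁
Dense = Σ Subset IsDense

IsSuc : (ℕ → Seq) → Set
IsSuc x = ∀ s → ∃[ k ] (∀ i → k ≤ i → x i ≺ s)

SucSeq : Set₁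
SucSeq = Lift (suc zero) (Σ (ℕ → Seq) IsSuc)

_⊥*ᴰ_ : Nwd → Dense → Set
N ⊥*ᴰ D = FiniteSubset (λ s → proj₁ N s × proj₁ D s)

_⊥*ˢ_ : Nwd → SucSeq → Set
N ⊥*ˢ x = FiniteNat (λ i → proj₁ N (proj₁ (lower x) i))

record RelSys : Set₂ where
  field
    A₋ : Set₁
    A₊ : Set₁
    R  : A₋ → A₊ → Set

record _≤T_ (𝐀 𝐁 : RelSys) : Set₁ where
  open RelSys
  field
    φ₋ : A₋ 𝐀 → A₋ 𝐁
    φ₊ : A₊ 𝐁 → A₊ 𝐀
    connection : ∀ a b → R 𝐁 (φ₋ a) b → R 𝐀 a (φ₊ b)

_≡T_ : RelSys → RelSys → Set₁
𝐀 ≡T 𝐁 = (𝐀 ≤T 𝐁) × (𝐁 ≤T 𝐀)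

NwdSuc : RelSys
NwdSuc = record { A₋ = Nwd ; A₊ = SucSeq ; R = _⊥*ˢ_ }

𝐃 : RelSys
𝐃 = record { A₋ = Nwd ; A₊ = Dense ; R = _⊥*ᴰ_ }

-- A dense D yields points x i ∈ D extending 0ⁱ; they converge to the left end of the order,
-- and since x i has length at least i, a finite N ∩ D meets only finitely many of them.
-- Conversely, a sequence x converging to the left end eventually has arbitrarily many leading
-- zeros, so D x = {s ++ x i : |s| ≤ lz (x i)} is dense, and N ∩ D x consists of the s ++ x i
-- with x i in N' = {y : s ++ y ∈ N for some |s| ≤ lz y}. To see that N' is nowhere dense,
-- read "nowhere dense" as "disjoint from a decidable open dense set" (the set strictly
-- above a maximal antichain; conversely the minimal elements of an open dense set): an open
-- dense P disjoint from N can be entered from all of the finitely many s ++ y at once.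
module Submission where

open import Defs
open import Level using (lift)
open import Data.Bool using (true; false)
open import Data.Bool.Properties using () renaming (_≟_ to _≟ᵇ_)
open import Data.List using (List; []; _∷_; _++_; [_]; length; map; concat; applyUpTo; replicate)
open import Data.List.Properties using (++-assoc; ++-identityʳ; length-++-≤ˡ; length-replicate; ∷-injective)
open import Data.List.Membership.Propositional using (_∈_)
open import Data.List.Membership.Propositional.Properties
  using (∈-map⁺; ∈-++⁺ˡ; ∈-++⁺ʳ; ∈-concat⁺′; ∈-applyUpTo⁺)
open import Data.List.Membership.DecPropositional _≟ᵇ_ using (_∈?_)
open import Data.List.Relation.Unary.Any using (here; there)
open import Data.List.Relation.Unary.All as All using (All; [])
open import Data.List.Extrema.Nat using (argmax; f[xs]≤f[argmax])
open import Data.Nat using (ℕ; zero; suc; _≤_; _<_; z≤n; s≤s)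
open import Data.Nat.Properties using (≤-refl; ≤-trans)
open import Data.Product using (Σ; _×_; _,_; proj₁; proj₂; ∃-syntax)
open import Data.Sum as Sum using (_⊎_; inj₁; inj₂)
open import Data.Empty using (⊥-elim)
open import Function using (id)
open import Relation.Nullary using (¬_; yes; no)
open import Relation.Nullary.Decidable using (_×-dec_)
open import Relation.Unary using (Decidable) renaming (_⊥_ to Disjoint)
open import Relation.Binary.PropositionalEquality using (_≡_; refl; sym; trans; cong; subst)

_⊏_ : Seq → Seq → Set
s ⊏ t = ∃[ b ] ∃[ u ] (s ++ b ∷ u ≡ t)

⊑-refl : ∀ s → s ⊑ s
⊑-refl s = [] , ++-identityʳ s

⊑-trans : ∀ {r s t} → r ⊑ s → s ⊑ t → r ⊑ t
⊑-trans {r} (u , refl) (v , refl) = u ++ v , sym (++-assoc r u v)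

++⁺-⊑ : ∀ s {y z} → y ⊑ z → (s ++ y) ⊑ (s ++ z)
++⁺-⊑ s {y} (u , refl) = u , ++-assoc s y u

∷⁺-⊑ : ∀ b {s t} → s ⊑ t → (b ∷ s) ⊑ (b ∷ t)
∷⁺-⊑ b (u , e) = u , cong (b ∷_) e

⊏⇒⊑ : ∀ {s t} → s ⊏ t → s ⊑ t
⊏⇒⊑ (b , u , e) = b ∷ u , e

⊑⇒≡⊎⊏ : ∀ {s t} → s ⊑ t → s ≡ t ⊎ s ⊏ t
⊑⇒≡⊎⊏ {s} ([] , e) = inj₁ (trans (sym (++-identityʳ s)) e)
⊑⇒≡⊎⊏ (b ∷ u , e) = inj₂ (b , u , e)

⊏-⊑-trans : ∀ {r s t} → r ⊏ s → s ⊑ t → r ⊏ t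
⊏-⊑-trans {r} (b , u , refl) (v , refl) = b , u ++ v , sym (++-assoc r (b ∷ u) v)

⊑⇒⊏-∷ʳ : ∀ {s t} b → s ⊑ t → s ⊏ (t ++ [ b ])
⊑⇒⊏-∷ʳ {s} b ([] , refl) = b , [] , cong (_++ [ b ]) (sym (++-identityʳ s))
⊑⇒⊏-∷ʳ {s} b (c ∷ u , refl) = c , u ++ [ b ] , sym (++-assoc s (c ∷ u) [ b ])

⊏-irrefl : ∀ {s} → ¬ s ⊏ s
⊏-irrefl {[]} (_ , _ , ())
⊏-irrefl {x ∷ s} (b , u , e) = ⊏-irrefl (b , u , proj₂ (∷-injective e))

⊏-⊑-asym : ∀ {s t} → s ⊏ t → ¬ t ⊑ s
⊏-⊑-asym s⊏t t⊑s = ⊏-irrefl (⊏-⊑-trans s⊏t t⊑s)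

¬⊏[] : ∀ {s} → ¬ s ⊏ []
¬⊏[] {[]} (_ , _ , ())
¬⊏[] {_ ∷ _} (_ , _ , ())

⊑-compatible : ∀ {r s t} → r ⊑ t → s ⊑ t → Compatible r s
⊑-compatible {[]} {s} _ _ = inj₁ (s , refl)
⊑-compatible {x ∷ r} {[]} _ _ = inj₂ (x ∷ r , refl)
⊑-compatible {x ∷ r} {y ∷ s} (u , refl) (v , e) with ∷-injective e
... | refl , e′ = Sum.map (∷⁺-⊑ x) (∷⁺-⊑ x) (⊑-compatible {r} {s} (u , refl) (v , e′))

∈-⊑ : ∀ {b s t} → b ∈ s → s ⊑ t → b ∈ t
∈-⊑ b∈s (u , refl) = ∈-++⁺ˡ b∈s

⊑⇒length≤ : ∀ {s t} → s ⊑ t → length s ≤ length t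
⊑⇒length≤ {s} (u , refl) = length-++-≤ˡ s

boundedSeqs : ℕ → List Seq
boundedSeqs zero = [ [] ]
boundedSeqs (suc m) = [] ∷ map (false ∷_) (boundedSeqs m) ++ map (true ∷_) (boundedSeqs m)

∈-boundedSeqs : ∀ {m} s → length s ≤ m → s ∈ boundedSeqs m
∈-boundedSeqs {zero} [] _ = here refl
∈-boundedSeqs {suc m} [] _ = here refl
∈-boundedSeqs {suc m} (false ∷ s) (s≤s l) =
  there (∈-++⁺ˡ (∈-map⁺ (false ∷_) (∈-boundedSeqs s l)))
∈-boundedSeqs {suc m} (true ∷ s) (s≤s l) =
  there (∈-++⁺ʳ (map (false ∷_) (boundedSeqs m)) (∈-map⁺ (true ∷_) (∈-boundedSeqs s l)))

leadingZeros : Seq → ℕ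
leadingZeros [] = zero
leadingZeros (false ∷ s) = suc (leadingZeros s)
leadingZeros (true ∷ s) = zero

leadingZeros-⊑ : ∀ {s t} → true ∈ s → s ⊑ t → leadingZeros t ≡ leadingZeros s
leadingZeros-⊑ {true ∷ s} _ (u , refl) = refl
leadingZeros-⊑ {false ∷ s} (there t∈s) (u , refl) = cong suc (leadingZeros-⊑ t∈s (u , refl))

replicate-⊑⇒≤leadingZeros : ∀ n {t} → replicate n false ⊑ t → n ≤ leadingZeros t
replicate-⊑⇒≤leadingZeros zero _ = z≤n
replicate-⊑⇒≤leadingZeros (suc n) (u , refl) = s≤s (replicate-⊑⇒≤leadingZeros n (u , refl))

true∉replicate : ∀ n → ¬ true ∈ replicate n false
true∉replicate (suc n) (there t∈) = true∉replicate n t∈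

∷⁺-≺ : ∀ b {s t} → s ≺ t → (b ∷ s) ≺ (b ∷ t)
∷⁺-≺ b (inj₁ (u , e)) = inj₁ (u , cong (b ∷_) e)
∷⁺-≺ b (inj₂ (inj₁ (v , e))) = inj₂ (inj₁ (v , cong (b ∷_) e))
∷⁺-≺ b (inj₂ (inj₂ (c , u , v , e₁ , e₂))) =
  inj₂ (inj₂ (b ∷ c , u , v , cong (b ∷_) e₁ , cong (b ∷_) e₂))

replicate-⊑⇒≺ : ∀ s {i t} → length s < i → replicate i false ⊑ t → t ≺ s
replicate-⊑⇒≺ [] {suc i} _ (u , refl) = inj₁ (replicate i false ++ u , refl)
replicate-⊑⇒≺ (false ∷ s) {suc i} (s≤s l) (u , refl) = ∷⁺-≺ false (replicate-⊑⇒≺ s l (u , refl))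
replicate-⊑⇒≺ (true ∷ s) {suc i} _ (u , refl) = inj₂ (inj₂ ([] , replicate i false ++ u , s , refl , refl))

≺-replicate⇒≤leadingZeros : ∀ {s} n → s ≺ replicate n false → n ≤ leadingZeros s
≺-replicate⇒≤leadingZeros n (inj₁ (u , refl)) = replicate-⊑⇒≤leadingZeros n (false ∷ u , refl)
≺-replicate⇒≤leadingZeros {s} n (inj₂ (inj₁ (v , e))) =
  ⊥-elim (true∉replicate n (subst (true ∈_) (sym e) (∈-++⁺ʳ s (here refl))))
≺-replicate⇒≤leadingZeros n (inj₂ (inj₂ (c , u , v , _ , e))) =
  ⊥-elim (true∉replicate n (subst (true ∈_) (sym e) (∈-++⁺ʳ c (here refl))))

record IsOpenDense (P : Subset) : Set where
  field
    decidable : Decidable P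
    upward : ∀ {s t} → s ⊑ t → P s → P t
    dense : IsDense P

Minimal : Subset → Subset
Minimal P t = P t × (∀ {s} → s ⊏ t → ¬ P s)

minimal-prefix : ∀ {P} → Decidable P → ∀ t → P t → ∃[ m ] (m ⊑ t × Minimal P m)
minimal-prefix P? t Pt with P? []
... | yes P[] = [] , (t , refl) , P[] , λ s⊏[] → ⊥-elim (¬⊏[] s⊏[])
minimal-prefix P? [] P[] | no ¬P[] = ⊥-elim (¬P[] P[])
minimal-prefix {P} P? (b ∷ t) Pbt | no ¬P[]
  with minimal-prefix {λ s → P (b ∷ s)} (λ s → P? (b ∷ s)) t Pbt
... | m , m⊑t , Pbm , min = b ∷ m , ∷⁺-⊑ b m⊑t , Pbm , below
  where
  below : ∀ {s} → s ⊏ (b ∷ m) → ¬ P s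
  below {[]} _ = ¬P[]
  below {c ∷ s} (d , u , e) with ∷-injective e
  ... | refl , e′ = min (d , u , e′)

module _ {P : Subset} (open-dense : IsOpenDense P) where
  open IsOpenDense open-dense

  Minimal-antichain : IsAntichain (Minimal P)
  Minimal-antichain s t (Ps , _) (_ , minimal-t) s⊑t with ⊑⇒≡⊎⊏ s⊑t
  ... | inj₁ s≡t = s≡t
  ... | inj₂ s⊏t = ⊥-elim (minimal-t s⊏t Ps)

  minimal-compatible : ∀ s → ∃[ m ] (Minimal P m × Compatible s m)
  minimal-compatible s with dense s
  ... | t , s⊑t , Pt with minimal-prefix decidable t Pt
  ...   | m , m⊑t , minimal-m = m , minimal-m , ⊑-compatible s⊑t m⊑t

  ∉⇒⊑minimal : ∀ {s} → ¬ P s → ∃[ m ] (Minimal P m × s ⊑ m)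
  ∉⇒⊑minimal {s} ¬Ps with minimal-compatible s
  ... | m , minimal-m , inj₁ s⊑m = m , minimal-m , s⊑m
  ... | m , (Pm , _) , inj₂ m⊑s = ⊥-elim (¬Ps (upward m⊑s Pm))

  open-dense⇒nwd : ∀ {N} → Disjoint N P → IsNwd N
  open-dense⇒nwd disjoint =
    Minimal P , (Minimal-antichain , minimal-compatible) ,
    λ s Ns → ∉⇒⊑minimal (λ Ps → disjoint (Ns , Ps))

Above : Subset → Subset
Above A s = ∃[ a ] (A a × a ⊏ s)

module _ {A : Subset} (antichain : IsAntichain A) where

  ⊑antichain⇒∉Above : ∀ {s t} → A t → s ⊑ t → ¬ Above A s
  ⊑antichain⇒∉Above {t = t} At s⊑t (a , Aa , a⊏s)
    with antichain a t Aa At (⊏⇒⊑ (⊏-⊑-trans a⊏s s⊑t))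
  ... | refl = ⊏-⊑-asym a⊏s s⊑t

  Above-open-dense : (∀ s → ∃[ t ] (A t × Compatible s t)) → IsOpenDense (Above A)
  Above-open-dense maximal = record { decidable = decidable ; upward = upward ; dense = dense }
    where
    decidable : Decidable (Above A)
    decidable s with maximal s
    ... | t , At , inj₁ s⊑t = no (⊑antichain⇒∉Above At s⊑t)
    ... | t , At , inj₂ t⊑s with ⊑⇒≡⊎⊏ t⊑s
    ...   | inj₁ refl = no (⊑antichain⇒∉Above At (⊑-refl s))
    ...   | inj₂ t⊏s = yes (t , At , t⊏s)

    upward : ∀ {s t} → s ⊑ t → Above A s → Above A t
    upward s⊑t (a , Aa , a⊏s) = a , Aa , ⊏-⊑-trans a⊏s s⊑t

    dense : IsDense (Above A)
    dense s with maximal s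
    ... | t , At , inj₁ s⊑t =
      t ++ [ false ] , ⊑-trans s⊑t ([ false ] , refl) , t , At , ⊑⇒⊏-∷ʳ false (⊑-refl t)
    ... | t , At , inj₂ t⊑s = s ++ [ false ] , ([ false ] , refl) , t , At , ⊑⇒⊏-∷ʳ false t⊑s

nwd⇒open-dense : ∀ {N} → IsNwd N → Σ Subset (λ P → IsOpenDense P × Disjoint N P)
nwd⇒open-dense (A , (antichain , maximal) , covered) =
  Above A , Above-open-dense antichain maximal ,
  λ { {s} (Ns , above) → let t , At , s⊑t = covered s Ns in ⊑antichain⇒∉Above antichain At s⊑t above }

Tails : Subset → Subset
Tails N y = ∃[ s ] (length s ≤ leadingZeros y × N (s ++ y))

-- The condition true ∈ y makes the set open: appending to y no longer changes leadingZeros y.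
RobustTails : Subset → Subset
RobustTails P y = true ∈ y × All (λ s → P (s ++ y)) (boundedSeqs (leadingZeros y))

module _ {P : Subset} (open-dense : IsOpenDense P) where
  open IsOpenDense open-dense

  extend-into-all : ∀ L y → ∃[ z ] (y ⊑ z × All (λ s → P (s ++ z)) L)
  extend-into-all [] y = y , ⊑-refl y , []
  extend-into-all (s ∷ L) y with extend-into-all L y
  ... | z , y⊑z , Ps++z with dense (s ++ z)
  ...   | _ , (v , refl) , Pt =
    z ++ v , ⊑-trans y⊑z (v , refl) ,
    subst P (++-assoc s z v) Pt All.∷ All.map (λ {s′} → upward (++⁺-⊑ s′ (v , refl))) Ps++z

  RobustTails-open-dense : IsOpenDense (RobustTails P)
  RobustTails-open-dense = record { decidable = decidable′ ; upward = upward′ ; dense = dense′ }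
    where
    decidable′ : Decidable (RobustTails P)
    decidable′ y = (true ∈? y) ×-dec All.all? (λ s → decidable (s ++ y)) (boundedSeqs (leadingZeros y))

    upward′ : ∀ {y z} → y ⊑ z → RobustTails P y → RobustTails P z
    upward′ {z = z} y⊑z (t∈y , Ps++y) =
      ∈-⊑ t∈y y⊑z ,
      subst (λ n → All (λ s → P (s ++ z)) (boundedSeqs n)) (sym (leadingZeros-⊑ t∈y y⊑z))
        (All.map (λ {s} → upward (++⁺-⊑ s y⊑z)) Ps++y)

    dense′ : IsDense (RobustTails P)
    dense′ y with extend-into-all (boundedSeqs (leadingZeros (y ++ [ true ]))) (y ++ [ true ])
    ... | z , y₁⊑z , Ps++z =
      z , ⊑-trans ([ true ] , refl) y₁⊑z , ∈-⊑ t∈y₁ y₁⊑z ,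
      subst (λ n → All (λ s → P (s ++ z)) (boundedSeqs n)) (sym (leadingZeros-⊑ t∈y₁ y₁⊑z)) Ps++z
      where
      t∈y₁ : true ∈ y ++ [ true ]
      t∈y₁ = ∈-++⁺ʳ y (here refl)

Tails-RobustTails-disjoint : ∀ {N P} → Disjoint N P → Disjoint (Tails N) (RobustTails P)
Tails-RobustTails-disjoint disjoint {y} ((s , s≤ , Ns++y) , (_ , Ps++y)) =
  disjoint {s ++ y} (Ns++y , All.lookup Ps++y (∈-boundedSeqs s s≤))

Tails-nwd : ∀ {N} → IsNwd N → IsNwd (Tails N)
Tails-nwd {N} nwd =
  let P , open-dense , disjoint = nwd⇒open-dense nwd
  in open-dense⇒nwd (RobustTails-open-dense open-dense) (Tails-RobustTails-disjoint {N} {P} disjoint)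

Prepended : (ℕ → Seq) → Subset
Prepended x t = ∃[ s ] ∃[ i ] (length s ≤ leadingZeros (x i) × t ≡ s ++ x i)

Prepended-dense : ∀ {x} → IsSuc x → IsDense (Prepended x)
Prepended-dense {x} converges s =
  let k , below = converges (replicate (length s) false)
  in s ++ x k , (x k , refl) , s , k , ≺-replicate⇒≤leadingZeros (length s) (below k ≤-refl) , refl

prependedUpTo : (ℕ → Seq) → ℕ → List Seq
prependedUpTo x K = concat (applyUpTo (λ i → map (_++ x i) (boundedSeqs (leadingZeros (x i)))) K)

∈-prependedUpTo : ∀ x {K i} s → i < K → length s ≤ leadingZeros (x i) → s ++ x i ∈ prependedUpTo x K
∈-prependedUpTo x s i<K s≤ =
  ∈-concat⁺′ (∈-map⁺ (_++ x _) (∈-boundedSeqs s s≤))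
             (∈-applyUpTo⁺ (λ i → map (_++ x i) (boundedSeqs (leadingZeros (x i)))) i<K)

𝐃≤NwdSuc : 𝐃 ≤T NwdSuc
𝐃≤NwdSuc = record
  { φ₋ = λ (N , nwd) → Tails N , Tails-nwd nwd
  ; φ₊ = λ (lift (x , converges)) → Prepended x , Prepended-dense converges
  ; connection = λ { _ (lift (x , _)) (K , bound) →
      prependedUpTo x K , λ { _ (Nt , s , i , s≤ , refl) → ∈-prependedUpTo x s (bound i (s , s≤ , Nt)) s≤ } }
  }

extendZeros : Dense → ℕ → Seq
extendZeros (_ , dense) i = proj₁ (dense (replicate i false))

replicate-⊑-extendZeros : ∀ (D : Dense) i → replicate i false ⊑ extendZeros D i
replicate-⊑-extendZeros (_ , dense) i = proj₁ (proj₂ (dense (replicate i false)))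

extendZeros-∈ : ∀ (D : Dense) i → proj₁ D (extendZeros D i)
extendZeros-∈ (_ , dense) i = proj₂ (proj₂ (dense (replicate i false)))

≤length-extendZeros : ∀ (D : Dense) i → i ≤ length (extendZeros D i)
≤length-extendZeros D i =
  subst (_≤ length (extendZeros D i)) (length-replicate i) (⊑⇒length≤ (replicate-⊑-extendZeros D i))

extendZeros-isSuc : ∀ (D : Dense) → IsSuc (extendZeros D)
extendZeros-isSuc D s = suc (length s) , λ i l → replicate-⊑⇒≺ s l (replicate-⊑-extendZeros D i)

NwdSuc≤𝐃 : NwdSuc ≤T 𝐃
NwdSuc≤𝐃 = record
  { φ₋ = id
  ; φ₊ = λ D → lift (extendZeros D , extendZeros-isSuc D)
  ; connection = λ N D (xs , finite) →
      suc (length (argmax length [] xs)) , λ i Nxi →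
        s≤s (≤-trans (≤length-extendZeros D i)
                     (All.lookup (f[xs]≤f[argmax] {f = length} [] xs) (finite _ (Nxi , extendZeros-∈ D i))))
  }

lemma4p7 : NwdSuc ≡T 𝐃
lemma4p7 = NwdSuc≤𝐃 , 𝐃≤NwdSuc
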